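{- Let $\mathbf P=(P,\leq,{}',0,1)$ be an orthogonal lub-complete poset. Then the following conditions are equivalent: (i) $\mathbf P$ is an orthomodular poset; (ii) for all $x,y\in P$: $x\leq y$ if and only if $x\rightarrow_S y=\{1\}$; (iii) for all $x,y\in P$: $x\leq y$ if and only if $x\rightarrow_D y=\{1\}$.
   Context: For a poset $(P,\leq)$ and $A\subseteq P$: $L(A)=\{x\in P: x\leq a\ \forall a\in A\}$, $L(x,y)=L(\{x,y\})$. $\operatorname{Max}A$ denotes the set of maximal elements of $A$. $x\vee y$, $x\wedge y$ denote supremum/infimum when they exist. A bounded poset $(P,\leq,{}',0,1)$ with antitone involution satisfies $x\leq y\Rightarrow y'\leq x'$ and $x''=x$. $x\perp y$ means $x\leq y'$. It is orthogonal if $x\perp y$ implies that $x\vee y$ exists; lub-complete if for every finite $M\subseteq P$ and every lower bound $x$ of $M$ there is a maximal element of $L(M)$ above $x$. An orthomodular poset is an orthogonal poset such that $x\leq y$ implies $x\vee(y\wedge x')=y$ (with $y\wedge x'=(y'\vee x)'$). The Sasaki implication is $x\rightarrow_S y:=\{x'\vee a: a\in\operatorname{Max}L(x,y)\}$ and the Dishkant implication is $x\rightarrow_D y:=y'\rightarrow_S x'=\{y\vee b: b\in\operatorname{Max}L(x',y')\}$. -}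

module Defs where

open import Data.Product using (Σ; _×_; _,_)
open import Data.List using (List; _∷_; [])
open import Data.List.Relation.Unary.All using (All)
open import Relation.Binary.PropositionalEquality using (_≡_)
open import Relation.Binary.Structures using (IsPartialOrder)

record BoundedInvPoset : Set₁ where
  infix 4 _≤_
  field
    Carrier   : Set
    _≤_       : Carrier → Carrier → Set
    isPartialOrder : IsPartialOrder _≡_ _≤_
    _′        : Carrier → Carrier
    𝟎 𝟏       : Carrier
    bot       : ∀ x → 𝟎 ≤ x
    top       : ∀ x → x ≤ 𝟏
    antitone  : ∀ {x y} → x ≤ y → (y ′) ≤ (x ′)
    involutive : ∀ x → ((x ′) ′) ≡ x

  _⊥_ : Carrier → Carrier → Set
  x ⊥ y = x ≤ (y ′)

  IsSup : Carrier → Carrier → Carrier → Set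
  IsSup x y s = x ≤ s × y ≤ s × (∀ z → x ≤ z → y ≤ z → s ≤ z)

  L : List Carrier → Carrier → Set
  L M z = All (z ≤_) M

  IsMax : (Carrier → Set) → Carrier → Set
  IsMax A a = A a × (∀ b → A b → a ≤ b → b ≡ a)

  IsOrthogonal : Set
  IsOrthogonal = ∀ x y → x ⊥ y → Σ Carrier (IsSup x y)

  IsLubComplete : Set
  IsLubComplete = ∀ (M : List Carrier) x → L M x →
    Σ Carrier (λ m → IsMax (L M) m × x ≤ m)

  -- orthogonal and  x ≤ y ⇒ x ∨ (y ∧ x') = y,  where y ∧ x' = (y' ∨ x)'
  IsOrthomodular : Set
  IsOrthomodular = IsOrthogonal ×
    (∀ x y → x ≤ y → ∀ s → IsSup (y ′) x s → IsSup x (s ′) y)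

  _∈Sasaki[_,_] : Carrier → Carrier → Carrier → Set
  z ∈Sasaki[ x , y ] = Σ Carrier (λ a → IsMax (L (x ∷ y ∷ [])) a × IsSup (x ′) a z)

  _∈Dishkant[_,_] : Carrier → Carrier → Carrier → Set
  z ∈Dishkant[ x , y ] = z ∈Sasaki[ y ′ , x ′ ]

  IsTopSingleton : (Carrier → Set) → Set
  IsTopSingleton S = S 𝟏 × (∀ z → S z → z ≡ 𝟏)

-- In an orthomodular poset x′ ∨ x = 1, and if x ≤ y then Max L(x, y) = {x}, so x →S y = {1}.
-- Conversely, if a ∈ Max L(x, y) and x′ ∨ a = 1, orthomodularity gives x = a ∨ (x′ ∨ a)′ = a ∨ 0 = a,
-- hence x ≤ y. For the converse implication, x →S x = {1} yields x′ ∨ x = 1, and for x ≤ y and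
-- t = x ∨ (y′ ∨ x)′ ≤ y every upper bound of y′ and t lies above both y′ ∨ x and its complement,
-- so y →S t = {1} and therefore y ≤ t. The Dishkant case is the Sasaki case for y′ and x′.
module Submission where

open import Defs
open import Data.Product using (_×_; _,_; proj₁; proj₂)
open import Data.List using (_∷_; [])
open import Data.List.Relation.Unary.All using (_∷_; [])
open import Function.Bundles using (_⇔_; mk⇔; Equivalence)
import Function.Properties.Equivalence as ⇔
open import Relation.Binary.PropositionalEquality using (_≡_; sym; subst; subst₂)
open import Relation.Binary.Structures using (IsPartialOrder)

module _ (P : BoundedInvPoset) where
  open BoundedInvPoset P
  open IsPartialOrder isPartialOrder using (antisym; trans) renaming (refl to ≤-refl)
  open Equivalence using (to; from)

  IsSup-unique : ∀ {x y s t} → IsSup x y s → IsSup x y t → s ≡ t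
  IsSup-unique (x≤s , y≤s , s-least) (x≤t , y≤t , t-least) =
    antisym (s-least _ x≤t y≤t) (t-least _ x≤s y≤s)

  IsSup-comm : ∀ {x y s} → IsSup x y s → IsSup y x s
  IsSup-comm (x≤s , y≤s , s-least) = y≤s , x≤s , λ z y≤z x≤z → s-least z x≤z y≤z

  𝟏′≤𝟎 : 𝟏 ′ ≤ 𝟎
  𝟏′≤𝟎 = subst (𝟏 ′ ≤_) (involutive 𝟎) (antitone (top (𝟎 ′)))

  IsSup-𝟏′ : ∀ x → IsSup x (𝟏 ′) x
  IsSup-𝟏′ x = ≤-refl , trans 𝟏′≤𝟎 (bot x) , λ z x≤z _ → x≤z

  ≤⇔′≥ : ∀ {x y} → (x ≤ y) ⇔ (y ′ ≤ x ′)
  ≤⇔′≥ {x} {y} = mk⇔ antitone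
    (λ y′≤x′ → subst₂ _≤_ (involutive x) (involutive y) (antitone y′≤x′))

  IsGreatest : (Carrier → Set) → Carrier → Set
  IsGreatest A m = A m × (∀ b → A b → b ≤ m)

  IsGreatest⇒IsMax : ∀ {A m} → IsGreatest A m → IsMax A m
  IsGreatest⇒IsMax (Am , greatest) = Am , λ b Ab m≤b → antisym (greatest b Ab) m≤b

  IsMax-IsGreatest-unique : ∀ {A m a} → IsGreatest A m → IsMax A a → a ≡ m
  IsMax-IsGreatest-unique (Am , greatest) (Aa , maximal) = sym (maximal _ Am (greatest _ Aa))

  ≤⇒IsGreatest-L-left : ∀ {x y} → x ≤ y → IsGreatest (L (x ∷ y ∷ [])) x
  ≤⇒IsGreatest-L-left x≤y = (≤-refl ∷ x≤y ∷ []) , λ { b (b≤x ∷ _ ∷ []) → b≤x }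

  ≤⇒IsGreatest-L-right : ∀ {x y} → y ≤ x → IsGreatest (L (x ∷ y ∷ [])) y
  ≤⇒IsGreatest-L-right y≤x = (y≤x ∷ ≤-refl ∷ []) , λ { b (_ ∷ b≤y ∷ []) → b≤y }

  SasakiCharacterisesOrder : Set
  SasakiCharacterisesOrder = ∀ x y → (x ≤ y) ⇔ IsTopSingleton (_∈Sasaki[ x , y ])

  DishkantCharacterisesOrder : Set
  DishkantCharacterisesOrder = ∀ x y → (x ≤ y) ⇔ IsTopSingleton (_∈Dishkant[ x , y ])

  Sasaki-IsTopSingleton : ∀ {x y m} → IsGreatest (L (x ∷ y ∷ [])) m → IsSup (x ′) m 𝟏 →
                          IsTopSingleton (_∈Sasaki[ x , y ])
  Sasaki-IsTopSingleton {x} m-greatest x′∨m≡𝟏 =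
    (_ , IsGreatest⇒IsMax m-greatest , x′∨m≡𝟏) ,
    λ { z (a , a-max , x′∨a≡z) →
          IsSup-unique x′∨a≡z
            (subst (λ a → IsSup (x ′) a 𝟏) (sym (IsMax-IsGreatest-unique m-greatest a-max)) x′∨m≡𝟏) }

  orthomodular⇒complemented : IsOrthomodular → ∀ x → IsSup (x ′) x 𝟏
  orthomodular⇒complemented (_ , om) x =
    IsSup-comm (om x 𝟏 (top x) x (IsSup-comm (IsSup-𝟏′ x)))

  orthomodular⇒Sasaki : IsOrthomodular → SasakiCharacterisesOrder
  orthomodular⇒Sasaki om x y = mk⇔
    (λ x≤y → Sasaki-IsTopSingleton (≤⇒IsGreatest-L-left x≤y) (orthomodular⇒complemented om x))
    top-in-Sasaki⇒≤
    where
    top-in-Sasaki⇒≤ : IsTopSingleton (_∈Sasaki[ x , y ]) → x ≤ y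
    top-in-Sasaki⇒≤ ((a , ((a≤x ∷ a≤y ∷ []) , _) , x′∨a≡𝟏) , _) = subst (_≤ y) (sym x≡a) a≤y
      where
      x≡a : x ≡ a
      x≡a = IsSup-unique (proj₂ om a x a≤x 𝟏 x′∨a≡𝟏) (IsSup-𝟏′ a)

  Sasaki⇒complemented : SasakiCharacterisesOrder → ∀ x → IsSup (x ′) x 𝟏
  Sasaki⇒complemented sasaki x with to (sasaki x x) ≤-refl
  ... | (a , a-max , x′∨a≡𝟏) , _ =
    subst (λ a → IsSup (x ′) a 𝟏) (IsMax-IsGreatest-unique (≤⇒IsGreatest-L-left ≤-refl) a-max) x′∨a≡𝟏

  Sasaki⇒orthomodular : IsOrthogonal → SasakiCharacterisesOrder → IsOrthomodular
  Sasaki⇒orthomodular orth sasaki = orth , orthomodular-law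
    where
    orthomodular-law : ∀ x y → x ≤ y → ∀ s → IsSup (y ′) x s → IsSup x (s ′) y
    orthomodular-law x y x≤y s (y′≤s , x≤s , s-least) = subst (IsSup x (s ′)) t≡y x∨s′≡t
      where
      x∨s′ = orth x (s ′) (subst (x ≤_) (sym (involutive s)) x≤s)
      t = proj₁ x∨s′
      x∨s′≡t = proj₂ x∨s′
      s′≤y : s ′ ≤ y
      s′≤y = subst (s ′ ≤_) (involutive y) (antitone y′≤s)
      t≤y : t ≤ y
      t≤y = proj₂ (proj₂ x∨s′≡t) y x≤y s′≤y
      y′∨t≡𝟏 : IsSup (y ′) t 𝟏
      y′∨t≡𝟏 = top _ , top _ , λ z y′≤z t≤z →
        proj₂ (proj₂ (Sasaki⇒complemented sasaki s)) z
          (trans (proj₁ (proj₂ x∨s′≡t)) t≤z)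
          (s-least z y′≤z (trans (proj₁ x∨s′≡t) t≤z))
      t≡y : t ≡ y
      t≡y = antisym t≤y (from (sasaki y t)
                             (Sasaki-IsTopSingleton (≤⇒IsGreatest-L-right t≤y) y′∨t≡𝟏))

  Sasaki⇒Dishkant : SasakiCharacterisesOrder → DishkantCharacterisesOrder
  Sasaki⇒Dishkant sasaki x y = ⇔.trans ≤⇔′≥ (sasaki (y ′) (x ′))

  Dishkant⇒Sasaki : DishkantCharacterisesOrder → SasakiCharacterisesOrder
  Dishkant⇒Sasaki dishkant x y =
    subst₂ (λ u v → (x ≤ y) ⇔ IsTopSingleton (_∈Sasaki[ u , v ]))
      (involutive x) (involutive y) (⇔.trans ≤⇔′≥ (dishkant (y ′) (x ′)))

theorem9 : (P : BoundedInvPoset) → let open BoundedInvPoset P in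
    IsOrthogonal → IsLubComplete →
    (IsOrthomodular ⇔ (∀ x y → (x ≤ y) ⇔ IsTopSingleton (_∈Sasaki[ x , y ])))
    × (IsOrthomodular ⇔ (∀ x y → (x ≤ y) ⇔ IsTopSingleton (_∈Dishkant[ x , y ])))
theorem9 P orth _ =
  mk⇔ (orthomodular⇒Sasaki P) (Sasaki⇒orthomodular P orth) ,
  mk⇔ (λ om → Sasaki⇒Dishkant P (orthomodular⇒Sasaki P om))
      (λ dishkant → Sasaki⇒orthomodular P orth (Dishkant⇒Sasaki P dishkant))
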